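{- Let $k\geq3$ and $n\geq3$ with $n$ odd, and let $\delta=1$ if $k$ is odd and $\delta=2$ if $k$ is even. Then $|N_1(n,k)| = \delta k^{(n-1)/2}$.
   Context: Tuples are $k$-ary (entries in $\mathbb{Z}_k$), negation is modulo $k$, $\mathbf{u}^R$ is the reverse of $\mathbf{u}$; a tuple $\mathbf{u}$ is negasymmetric if $\mathbf{u}=-\mathbf{u}^R$. The pseudoweight of $a\in\mathbb{Z}_k$ is $a$ if $a\ne0$ and $k/2$ if $a=0$, and of a tuple the sum over its entries. $B_k(n-1)$ is the de Bruijn digraph with vertices the $k$-ary $(n-1)$-tuples and edges the $k$-ary $n$-tuples $(a_0,\dots,a_{n-1})$ from $(a_0,\dots,a_{n-2})$ to $(a_1,\dots,a_{n-1})$; $H_k(n-1)$ is its subgraph of edges of pseudoweight exactly $kn/2$. For an $n$-tuple $(a_0,\dots,a_{n-1})$, with $p$ the least positive $c$ such that $a_i=a_{(i+c)\bmod n}$ for all $i$, $[a_0,\dots,a_{n-1}]$ is the circuit whose edges are the $p$ cyclic shifts $(a_j,\dots,a_{j+n-1})$ (indices mod $n$), $0\le j<p$. $\mathcal{C}_k(n-1)$ is the set of such circuits arising from edges of $H_k(n-1)$. A circuit is negasymmetric if it contains edges $\mathbf a,\mathbf b$ (not necessarily distinct) with $\mathbf a=-\mathbf b^R$. $N_1(n,k)$ is the set of negasymmetric circuits in $\mathcal{C}_k(n-1)$ containing exactly one negasymmetric $n$-tuple among their edges. -}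

module Defs where

open import Data.Nat using (ℕ; zero; suc; _+_; _*_; _∸_; _<_; _%_)
open import Data.Fin using (Fin; zero; suc; toℕ; opposite)
open import Data.Vec using (Vec; []; _∷_; _∷ʳ_; map; reverse; foldr)
open import Data.List using (List; length)
open import Data.List.Relation.Unary.All using (All)
open import Data.List.Relation.Unary.Any using (Any)
open import Data.List.Relation.Unary.AllPairs using (AllPairs)
open import Data.Product using (Σ; ∃; _×_)
open import Function.Bundles using (_⇔_)
open import Relation.Binary.PropositionalEquality using (_≡_; _≢_)
open import Relation.Nullary using (¬_)

-- k-ary n-tuples (entries in ℤ_k, represented by Fin k)
Tuple : ℕ → ℕ → Set
Tuple k n = Vec (Fin k) n

-- negation modulo k:  -0 = 0,  -(i+1) = k - (i+1)
negF : ∀ {k} → Fin k → Fin k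
negF zero    = zero
negF (suc i) = suc (opposite i)

negT : ∀ {k n} → Tuple k n → Tuple k n
negT = map negF

NegSym : ∀ {k n} → Tuple k n → Set
NegSym u = u ≡ negT (reverse u)

-- TWICE the pseudoweight of an entry: 2a if a ≠ 0, and k (= 2·(k/2)) if a = 0
pw2 : ∀ {k} → Fin k → ℕ
pw2 {k} zero    = k
pw2     (suc i) = 2 * suc (toℕ i)

pw2T : ∀ {k n} → Tuple k n → ℕ
pw2T = foldr _ (λ a s → pw2 a + s) 0

-- edge of H_k(n-1): pseudoweight exactly kn/2, i.e. twice pseudoweight = k·n
InH : ∀ {k n} → Tuple k n → Set
InH {k} {n} u = pw2T u ≡ k * n

rot1 : ∀ {A : Set} {n} → Vec A n → Vec A n
rot1 []       = []
rot1 (x ∷ xs) = xs ∷ʳ x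

rot : ∀ {A : Set} {n} → Vec A n → ℕ → Vec A n
rot a zero    = a
rot a (suc j) = rot1 (rot a j)

IsLeastPeriod : ∀ {k n} → Tuple k n → ℕ → Set
IsLeastPeriod a p = (0 < p) × (rot a p ≡ a) × (∀ c → 0 < c → c < p → rot a c ≢ a)

-- e is an edge of the circuit [a] : e is one of the p cyclic shifts rot a j, 0 ≤ j < p
EdgeOf : ∀ {k n} → Tuple k n → Tuple k n → Set
EdgeOf e a = Σ ℕ λ p → IsLeastPeriod a p × (Σ ℕ λ j → (j < p) × (e ≡ rot a j))

-- circuits are identified by their edge sets
SameCircuit : ∀ {k n} → Tuple k n → Tuple k n → Set
SameCircuit {k} {n} a b = ∀ (e : Tuple k n) → EdgeOf e a ⇔ EdgeOf e b

NegCircuit : ∀ {k n} → Tuple k n → Set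
NegCircuit {k} {n} a =
  Σ (Tuple k n) λ x → Σ (Tuple k n) λ y → EdgeOf x a × EdgeOf y a × (x ≡ negT (reverse y))

ExactlyOneNegSym : ∀ {k n} → Tuple k n → Set
ExactlyOneNegSym {k} {n} a =
  Σ (Tuple k n) λ u → EdgeOf u a × NegSym u ×
    (∀ v → EdgeOf v a → NegSym v → v ≡ u)

InN1 : ∀ {k n} → Tuple k n → Set
InN1 a = InH a × NegCircuit a × ExactlyOneNegSym a

-- |N_1(n,k)| = m : a list of generators listing each circuit of N_1(n,k) exactly once
CardN1 : ℕ → ℕ → ℕ → Set
CardN1 n k m =
  Σ (List (Tuple k n)) λ L →
    All InN1 L ×
    (∀ a → InN1 a → Any (SameCircuit a) L) ×
    AllPairs (λ a b → ¬ SameCircuit a b) L ×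
    (length L ≡ m)

delta : ℕ → ℕ
delta k with k % 2
... | zero  = 2
... | suc _ = 1

{-# OPTIONS --safe #-}
-- A negasymmetric tuple pairs each entry a with −a in the mirrored position, and the
-- pseudoweights of a and −a add up to k; so every negasymmetric n-tuple has pseudoweight kn/2.
-- If u and its rotation by j are both negasymmetric, rotating by 2j fixes u; for odd n this
-- forces the rotation by j to fix u, so a circuit has at most one negasymmetric edge. Hence
-- N_1(n,k) corresponds to the negasymmetric n-tuples, which are given freely by their first
-- (n−1)/2 entries together with a middle entry c = −c, and there are δ such c (0, and k/2 when
-- k is even).
module Submission where

open import Defs
open import Data.Nat
  using (ℕ; zero; suc; _+_; _*_; _∸_; _^_; _/_; _%_; _<_; _≤_; z≤n; s≤s; _<?_; >-nonZero)
open import Data.Nat.Properties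
  using ( ≤-refl; ≤-trans; m<1+n⇒m<n∨m≡n; m∸n+n≡m; m≤m*n; 0≢1+n
        ; +-comm; +-assoc; +-identityʳ; +-cancelʳ-≡; *-cancelʳ-≡; *-identityʳ)
open import Data.Nat.DivMod using (m≡m%n+[m/n]*n; m%n<n; m*n%n≡0; [m+kn]%n≡m%n; m*n/n≡m)
open import Data.Nat.Tactic.RingSolver using (solve-∀)
open import Data.Fin using (Fin; zero; suc; toℕ; fromℕ<; _≟_)
open import Data.Fin.Properties
  using (opposite-prop; opposite-involutive; toℕ-fromℕ<; toℕ-injective; toℕ<n)
open import Data.Vec using (Vec; []; _∷_; _∷ʳ_; map; reverse; toList; initLast)
open import Data.Vec.Properties
  using ( ∷-injective; ∷-injectiveˡ; ∷-injectiveʳ; ∷ʳ-injective; ∷ʳ-injectiveˡ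
        ; reverse-∷; reverse-involutive; reverse-reverse; map-∷ʳ; toList-∷ʳ; toList-injective; length-toList; cast-is-id; ≡-dec)
open import Data.List as List using (List; length; allFin; cartesianProductWith)
open import Data.List.Properties using (length-++; length-map; length-tabulate; ++-assoc; ++-identityʳ)
open import Data.List.Relation.Unary.All as All using (All; []; _∷_)
import Data.List.Relation.Unary.All.Properties as All
open import Data.List.Relation.Unary.Any as Any using (Any; here; there)
import Data.List.Relation.Unary.Any.Properties as Any
open import Data.List.Relation.Unary.AllPairs using (AllPairs; []; _∷_)
open import Data.List.Relation.Unary.Unique.Propositional using (Unique)
import Data.List.Relation.Unary.Unique.Propositional.Properties as Unique
open import Data.List.Membership.Propositional using (_∈_)
open import Data.List.Membership.Propositional.Properties using (∈-map⁺; ∈-allFin)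
open import Data.Product using (Σ; ∃; ∃-syntax; _×_; _,_)
open import Data.Sum using (_⊎_; inj₁; inj₂; [_,_])
open import Data.Empty using (⊥-elim)
open import Function.Base using (id; _∘_)
open import Function.Bundles using (mk⇔; Equivalence)
open import Relation.Nullary using (¬_; yes; no; contradiction)
open import Relation.Nullary.Decidable using (_×-dec_)
open import Relation.Unary using (Decidable)
open import Relation.Binary.PropositionalEquality
  using (_≡_; _≢_; refl; sym; trans; cong; cong₂; subst; setoid; module ≡-Reasoning)
open ≡-Reasoning

private variable
  A B : Set
  k m n : ℕ

n*2≡n+n : ∀ n → n * 2 ≡ n + n
n*2≡n+n = solve-∀

least-witness : {P : ℕ → Set} → Decidable P → P m → ∃[ c ] P c × (∀ {d} → d < c → ¬ P d)
least-witness {m = m} {P = P} P? Pm = [ (λ none → contradiction Pm (none ≤-refl)) , id ] (search (suc m))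
  where
  search : ∀ N → (∀ {c} → c < N → ¬ P c) ⊎ (∃[ c ] P c × (∀ {d} → d < c → ¬ P d))
  search zero = inj₁ λ ()
  search (suc N) with search N
  ... | inj₂ least = inj₂ least
  ... | inj₁ none with P? N
  ...   | yes PN = inj₂ (N , PN , none)
  ...   | no ¬PN = inj₁ λ c<1+N → [ none , (λ { refl → ¬PN }) ] (m<1+n⇒m<n∨m≡n c<1+N)

length-cartesianProductWith : {C : Set} (f : A → B → C) (xs : List A) (ys : List B) →
  length (cartesianProductWith f xs ys) ≡ length xs * length ys
length-cartesianProductWith f List.[]       ys = refl
length-cartesianProductWith f (x List.∷ xs) ys = begin
  length (List.map (f x) ys List.++ cartesianProductWith f xs ys) ≡⟨ length-++ (List.map (f x) ys) ⟩
  length (List.map (f x) ys) + length (cartesianProductWith f xs ys)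
    ≡⟨ cong₂ _+_ (length-map (f x) ys) (length-cartesianProductWith f xs ys) ⟩
  length ys + length xs * length ys ∎

allPairs-mapWith : {P : A → Set} {R S : A → A → Set} → (∀ {x y} → P x → P y → R x y → S x y) →
  ∀ {xs} → All P xs → AllPairs R xs → AllPairs S xs
allPairs-mapWith f []         []         = []
allPairs-mapWith f (px ∷ pxs) (rx ∷ rxs) =
  All.zipWith (λ (py , r) → f px py r) (pxs , rx) ∷ allPairs-mapWith f pxs rxs

rot-+ : (a : Vec A n) (i j : ℕ) → rot a (j + i) ≡ rot (rot a i) j
rot-+ a i zero    = refl
rot-+ a i (suc j) = cong rot1 (rot-+ a i j)

rot-suc : (a : Vec A n) (j : ℕ) → rot a (suc j) ≡ rot (rot1 a) j
rot-suc a zero    = refl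
rot-suc a (suc j) = cong rot1 (rot-suc a j)

rot-* : (a : Vec A n) (s : ℕ) → rot a s ≡ a → ∀ t → rot a (t * s) ≡ a
rot-* a s rot-s zero    = refl
rot-* a s rot-s (suc t) = begin
  rot a (s + t * s)       ≡⟨ rot-+ a (t * s) s ⟩
  rot (rot a (t * s)) s   ≡⟨ cong (λ b → rot b s) (rot-* a s rot-s t) ⟩
  rot a s                 ≡⟨ rot-s ⟩
  a                       ∎

private
  rotateₗ : List A → List A
  rotateₗ List.[]       = List.[]
  rotateₗ (x List.∷ xs) = xs List.++ List.[ x ]

  rotₗ : List A → ℕ → List A
  rotₗ xs zero    = xs
  rotₗ xs (suc j) = rotateₗ (rotₗ xs j)

  rotₗ-suc : (xs : List A) (j : ℕ) → rotₗ xs (suc j) ≡ rotₗ (rotateₗ xs) j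
  rotₗ-suc xs zero    = refl
  rotₗ-suc xs (suc j) = cong rotateₗ (rotₗ-suc xs j)

  rotₗ-++ : (xs ys : List A) → rotₗ (xs List.++ ys) (length xs) ≡ ys List.++ xs
  rotₗ-++ List.[]       ys = sym (++-identityʳ ys)
  rotₗ-++ (x List.∷ xs) ys = begin
    rotₗ (x List.∷ xs List.++ ys) (suc (length xs))       ≡⟨ rotₗ-suc _ (length xs) ⟩
    rotₗ ((xs List.++ ys) List.++ List.[ x ]) (length xs) ≡⟨ cong (λ zs → rotₗ zs (length xs)) (++-assoc xs ys _) ⟩
    rotₗ (xs List.++ ys List.++ List.[ x ]) (length xs)   ≡⟨ rotₗ-++ xs (ys List.++ List.[ x ]) ⟩
    (ys List.++ List.[ x ]) List.++ xs                    ≡⟨ ++-assoc ys List.[ x ] xs ⟩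
    ys List.++ x List.∷ xs                                ∎

  toList-rot : (a : Vec A n) (j : ℕ) → toList (rot a j) ≡ rotₗ (toList a) j
  toList-rot a zero    = refl
  toList-rot a (suc j) = trans (toList-rot1 (rot a j)) (cong rotateₗ (toList-rot a j))
    where
    toList-rot1 : (b : Vec A m) → toList (rot1 b) ≡ rotateₗ (toList b)
    toList-rot1 []       = refl
    toList-rot1 (x ∷ xs) = toList-∷ʳ x xs

  rotₗ-length : (xs : List A) → rotₗ xs (length xs) ≡ xs
  rotₗ-length xs = trans (cong (λ ys → rotₗ ys (length xs)) (sym (++-identityʳ xs))) (rotₗ-++ xs List.[])

-- Via lists: on vectors, rotating xs ++ ys by |xs| would need a cast from m + n to n + m.
rot-length : (a : Vec A n) → rot a n ≡ a
rot-length {n = n} a = trans (sym (cast-is-id refl (rot a n))) (toList-injective refl (rot a n) a (begin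
  toList (rot a n)                     ≡⟨ toList-rot a n ⟩
  rotₗ (toList a) n                    ≡⟨ cong (rotₗ (toList a)) (sym (length-toList a)) ⟩
  rotₗ (toList a) (length (toList a))  ≡⟨ rotₗ-length (toList a) ⟩
  toList a                             ∎))

rot-*-length-+ : (a : Vec A n) (t i : ℕ) → rot a (t * n + i) ≡ rot a i
rot-*-length-+ {n = n} a t i = trans (rot-+ a i (t * n)) (rot-* (rot a i) n (rot-length (rot a i)) t)

reverse-∷ʳ : (xs : Vec A n) (x : A) → reverse (xs ∷ʳ x) ≡ x ∷ reverse xs
reverse-∷ʳ xs x =
  reverse-reverse (trans (reverse-∷ x (reverse xs)) (cong (_∷ʳ x) (reverse-involutive xs)))

rot1-reverse-rot1 : (a : Vec A n) → rot1 (reverse (rot1 a)) ≡ reverse a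
rot1-reverse-rot1 []       = refl
rot1-reverse-rot1 (x ∷ xs) = begin
  rot1 (reverse (xs ∷ʳ x))  ≡⟨ cong rot1 (reverse-∷ʳ xs x) ⟩
  rot1 (x ∷ reverse xs)     ≡⟨ sym (reverse-∷ x xs) ⟩
  reverse (x ∷ xs)          ∎

rot-reverse-rot : (a : Vec A n) (j : ℕ) → rot (reverse (rot a j)) j ≡ reverse a
rot-reverse-rot a zero    = refl
rot-reverse-rot a (suc j) = begin
  rot (reverse (rot1 (rot a j))) (suc j)         ≡⟨ rot-suc _ j ⟩
  rot (rot1 (reverse (rot1 (rot a j)))) j        ≡⟨ cong (λ b → rot b j) (rot1-reverse-rot1 (rot a j)) ⟩
  rot (reverse (rot a j)) j                      ≡⟨ rot-reverse-rot a j ⟩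
  reverse a                                      ∎

map-rot1 : (f : A → B) (a : Vec A n) → map f (rot1 a) ≡ rot1 (map f a)
map-rot1 f []       = refl
map-rot1 f (x ∷ xs) = map-∷ʳ f x xs

map-rot : (f : A → B) (a : Vec A n) (j : ℕ) → map f (rot a j) ≡ rot (map f a) j
map-rot f a zero    = refl
map-rot f a (suc j) = trans (map-rot1 f (rot a j)) (cong rot1 (map-rot f a j))

negRev : Tuple k n → Tuple k n
negRev u = negT (reverse u)

rot-negRev-rot : (u : Tuple k n) (j : ℕ) → rot (negRev (rot u j)) j ≡ negRev u
rot-negRev-rot u j = trans (sym (map-rot negF (reverse (rot u j)) j)) (cong negT (rot-reverse-rot u j))

-- j + j is a period of u, and j ≡ (q + 1) · (j + j) modulo the odd length 2q + 1.
negSym-rot-unique : ∀ q (u : Tuple k (suc (q * 2))) j → NegSym u → NegSym (rot u j) → rot u j ≡ u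
negSym-rot-unique q u j u-ns rot-ns = begin
  rot u j                          ≡⟨ sym (rot-*-length-+ u j j) ⟩
  rot u (j * suc (q * 2) + j)      ≡⟨ cong (rot u) (arith q j) ⟩
  rot u (suc q * (j + j))          ≡⟨ rot-* u (j + j) rot-2j (suc q) ⟩
  u                                ∎
  where
  arith : ∀ q j → j * suc (q * 2) + j ≡ suc q * (j + j)
  arith = solve-∀
  rot-2j : rot u (j + j) ≡ u
  rot-2j = begin
    rot u (j + j)             ≡⟨ rot-+ u j j ⟩
    rot (rot u j) j           ≡⟨ cong (λ b → rot b j) rot-ns ⟩
    rot (negRev (rot u j)) j  ≡⟨ rot-negRev-rot u j ⟩
    negRev u                  ≡⟨ sym u-ns ⟩
    u                         ∎

leastPeriod : (a : Tuple k (suc n)) → ∃ (IsLeastPeriod a)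
leastPeriod {n = n} a
  with least-witness {m = suc n} (λ c → (0 <? c) ×-dec ≡-dec _≟_ (rot a c) a) (s≤s z≤n , rot-length a)
... | p , (0<p , rot-p) , below = p , 0<p , rot-p , λ c 0<c c<p rot-c → below c<p (0<c , rot-c)

rot-edgeOf : (a : Tuple k (suc n)) (i : ℕ) → EdgeOf (rot a i) a
rot-edgeOf a i with leastPeriod a
... | p , period@(0<p , rot-p , _) = p , period , i % p , m%n<n i p , (begin
  rot a i                          ≡⟨ cong (rot a) (m≡m%n+[m/n]*n i p) ⟩
  rot a (i % p + (i / p) * p)      ≡⟨ rot-+ a ((i / p) * p) (i % p) ⟩
  rot (rot a ((i / p) * p)) (i % p) ≡⟨ cong (λ b → rot b (i % p)) (rot-* a p rot-p (i / p)) ⟩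
  rot a (i % p)                    ∎)
  where instance _ = >-nonZero 0<p

edgeOf⇒rot : {e a : Tuple k n} → EdgeOf e a → ∃[ i ] e ≡ rot a i
edgeOf⇒rot (_ , _ , i , _ , e≡rot) = i , e≡rot

sameCircuit-rot : (a : Tuple k (suc n)) (j : ℕ) → SameCircuit a (rot a j)
sameCircuit-rot {n = n} a j e = mk⇔ to from
  where
  arith : ∀ j i n → j * suc n + i ≡ (i + j * n) + j
  arith = solve-∀
  -- i + j * n is i − j modulo the length suc n.
  to : EdgeOf e a → EdgeOf e (rot a j)
  to e∈a with edgeOf⇒rot e∈a
  ... | i , refl = subst (λ b → EdgeOf b (rot a j)) (begin
    rot (rot a j) (i + j * n)  ≡⟨ sym (rot-+ a j (i + j * n)) ⟩
    rot a ((i + j * n) + j)    ≡⟨ cong (rot a) (sym (arith j i n)) ⟩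
    rot a (j * suc n + i)      ≡⟨ rot-*-length-+ a j i ⟩
    rot a i                    ∎) (rot-edgeOf (rot a j) (i + j * n))
  from : EdgeOf e (rot a j) → EdgeOf e a
  from e∈rot with edgeOf⇒rot e∈rot
  ... | i , refl = subst (λ b → EdgeOf b a) (rot-+ a j i) (rot-edgeOf a (i + j))

pw2T-∷ʳ : (u : Tuple k n) (a : Fin k) → pw2T (u ∷ʳ a) ≡ pw2T u + pw2 a
pw2T-∷ʳ []      a = +-identityʳ (pw2 a)
pw2T-∷ʳ (b ∷ u) a = trans (cong (pw2 b +_) (pw2T-∷ʳ u a)) (sym (+-assoc (pw2 b) _ _))

pw2T-reverse : (u : Tuple k n) → pw2T (reverse u) ≡ pw2T u
pw2T-reverse []      = refl
pw2T-reverse (a ∷ u) = begin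
  pw2T (reverse (a ∷ u))      ≡⟨ cong pw2T (reverse-∷ a u) ⟩
  pw2T (reverse u ∷ʳ a)       ≡⟨ pw2T-∷ʳ (reverse u) a ⟩
  pw2T (reverse u) + pw2 a    ≡⟨ cong (_+ pw2 a) (pw2T-reverse u) ⟩
  pw2T u + pw2 a              ≡⟨ +-comm (pw2T u) (pw2 a) ⟩
  pw2 a + pw2T u              ∎

toℕ-negF-suc : (i : Fin k) → toℕ (negF (suc i)) + toℕ (suc i) ≡ suc k
toℕ-negF-suc i = cong suc (trans (cong (_+ suc (toℕ i)) (opposite-prop i)) (m∸n+n≡m (toℕ<n i)))

pw2-+-pw2-negF : (a : Fin k) → pw2 a + pw2 (negF a) ≡ k + k
pw2-+-pw2-negF zero          = refl
pw2-+-pw2-negF {suc k} (suc i) = begin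
  2 * toℕ (suc i) + 2 * toℕ (negF (suc i))  ≡⟨ arith (toℕ (suc i)) (toℕ (negF (suc i))) ⟩
  (toℕ (negF (suc i)) + toℕ (suc i)) * 2    ≡⟨ cong (_* 2) (toℕ-negF-suc i) ⟩
  suc k * 2                                 ≡⟨ n*2≡n+n (suc k) ⟩
  suc k + suc k                             ∎
  where
  arith : ∀ x y → 2 * x + 2 * y ≡ (y + x) * 2
  arith = solve-∀

pw2T-+-pw2T-negT : (u : Tuple k n) → pw2T u + pw2T (negT u) ≡ n * (k + k)
pw2T-+-pw2T-negT         []      = refl
pw2T-+-pw2T-negT {k} {suc n} (a ∷ u) = begin
  (pw2 a + pw2T u) + (pw2 (negF a) + pw2T (negT u))  ≡⟨ arith (pw2 a) (pw2T u) (pw2 (negF a)) _ ⟩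
  (pw2 a + pw2 (negF a)) + (pw2T u + pw2T (negT u))  ≡⟨ cong₂ _+_ (pw2-+-pw2-negF a) (pw2T-+-pw2T-negT u) ⟩
  (k + k) + n * (k + k)                              ∎
  where
  arith : ∀ x y z w → (x + y) + (z + w) ≡ (x + z) + (y + w)
  arith = solve-∀

negSym⇒InH : (u : Tuple k n) → NegSym u → InH u
negSym⇒InH {k} {n} u u-ns = *-cancelʳ-≡ (pw2T u) (k * n) 2 (begin
  pw2T u * 2                                  ≡⟨ n*2≡n+n (pw2T u) ⟩
  pw2T u + pw2T u                             ≡⟨ cong₂ _+_ (sym (pw2T-reverse u)) (cong pw2T u-ns) ⟩
  pw2T (reverse u) + pw2T (negT (reverse u))  ≡⟨ pw2T-+-pw2T-negT (reverse u) ⟩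
  n * (k + k)                                 ≡⟨ arith n k ⟩
  k * n * 2                                   ∎)
  where
  arith : ∀ n k → n * (k + k) ≡ k * n * 2
  arith = solve-∀

data EvenOrOdd : ℕ → Set where
  even : ∀ h → EvenOrOdd (h * 2)
  odd  : ∀ h → EvenOrOdd (suc (h * 2))

evenOrOdd : ∀ n → EvenOrOdd n
evenOrOdd zero = even 0
evenOrOdd (suc n) with evenOrOdd n
... | even h = odd h
... | odd h  = even (suc h)

[n*2]%2≡0 : ∀ n → n * 2 % 2 ≡ 0
[n*2]%2≡0 n = m*n%n≡0 n 2

[1+n*2]%2≡1 : ∀ n → suc (n * 2) % 2 ≡ 1
[1+n*2]%2≡1 n = [m+kn]%n≡m%n 1 n 2

m*2≢1+n*2 : ∀ m n → m * 2 ≢ suc (n * 2)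
m*2≢1+n*2 m n eq = 0≢1+n (trans (sym ([n*2]%2≡0 m)) (trans (cong (_% 2) eq) ([1+n*2]%2≡1 n)))

delta-even : ∀ h → delta (h * 2) ≡ 2
delta-even h rewrite [n*2]%2≡0 h = refl

delta-odd : ∀ h → delta (suc (h * 2)) ≡ 1
delta-odd h rewrite [1+n*2]%2≡1 h = refl

SelfNegating : Fin k → Set
SelfNegating c = c ≡ negF c

selfNegating-suc⇒ : (i : Fin k) → SelfNegating (suc i) → toℕ (suc i) * 2 ≡ suc k
selfNegating-suc⇒ i fixed = begin
  toℕ (suc i) * 2                     ≡⟨ n*2≡n+n (toℕ (suc i)) ⟩
  toℕ (suc i) + toℕ (suc i)           ≡⟨ cong (_+ toℕ (suc i)) (cong toℕ fixed) ⟩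
  toℕ (negF (suc i)) + toℕ (suc i)    ≡⟨ toℕ-negF-suc i ⟩
  suc _                               ∎

selfNegating⇐ : (c : Fin k) → toℕ c * 2 ≡ k → SelfNegating c
selfNegating⇐ zero    ()
selfNegating⇐ (suc i) twice = toℕ-injective (+-cancelʳ-≡ (toℕ (suc i)) _ _ (begin
  toℕ (suc i) + toℕ (suc i)           ≡⟨ sym (n*2≡n+n (toℕ (suc i))) ⟩
  toℕ (suc i) * 2                     ≡⟨ twice ⟩
  suc _                               ≡⟨ sym (toℕ-negF-suc i) ⟩
  toℕ (negF (suc i)) + toℕ (suc i)    ∎))

negF-involutive : (a : Fin k) → negF (negF a) ≡ a
negF-involutive zero    = refl
negF-involutive (suc i) = cong suc (opposite-involutive i)

negRev-∷-∷ʳ : (a : Fin k) (w : Tuple k n) (b : Fin k) →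
  negRev (a ∷ (w ∷ʳ b)) ≡ negF b ∷ (negRev w ∷ʳ negF a)
negRev-∷-∷ʳ a w b = begin
  negT (reverse (a ∷ (w ∷ʳ b)))   ≡⟨ cong negT (reverse-∷ a (w ∷ʳ b)) ⟩
  negT (reverse (w ∷ʳ b) ∷ʳ a)    ≡⟨ cong (λ v → negT (v ∷ʳ a)) (reverse-∷ʳ w b) ⟩
  negT ((b ∷ reverse w) ∷ʳ a)     ≡⟨ map-∷ʳ negF a (b ∷ reverse w) ⟩
  negF b ∷ (negRev w ∷ʳ negF a)   ∎

enclose : Fin k → Tuple k n → Tuple k (suc (suc n))
enclose a w = a ∷ (w ∷ʳ negF a)

enclose-injective : {a b : Fin k} {w v : Tuple k n} → enclose a w ≡ enclose b v → a ≡ b × w ≡ v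
enclose-injective {w = w} {v} eq with ∷-injective eq
... | refl , w≡v = refl , ∷ʳ-injectiveˡ w v w≡v

negSym-enclose : (a : Fin k) {w : Tuple k n} → NegSym w → NegSym (enclose a w)
negSym-enclose a {w} w-ns = begin
  a ∷ (w ∷ʳ negF a)                   ≡⟨ cong₂ (λ x v → x ∷ (v ∷ʳ negF a)) (sym (negF-involutive a)) w-ns ⟩
  negF (negF a) ∷ (negRev w ∷ʳ negF a) ≡⟨ sym (negRev-∷-∷ʳ a w (negF a)) ⟩
  negRev (enclose a w)                ∎

negSym-enclose⁻ : (a : Fin k) (w : Tuple k n) (b : Fin k) →
  NegSym (a ∷ (w ∷ʳ b)) → b ≡ negF a × NegSym w
negSym-enclose⁻ a w b ns with ∷ʳ-injective w (negRev w) (∷-injectiveʳ (trans ns (negRev-∷-∷ʳ a w b)))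
... | w-ns , b≡-a = b≡-a , w-ns

record Enumeration (P : A → Set) : Set where
  field
    elems    : List A
    sound    : All P elems
    complete : ∀ {x} → P x → x ∈ elems
    unique   : Unique elems
open Enumeration

selfNegating-odd : ∀ h → Enumeration (SelfNegating {suc (h * 2)})
selfNegating-odd h = record
  { elems    = List.[ zero ]
  ; sound    = refl ∷ []
  ; complete = λ { {zero} _ → here refl
                 ; {suc i} fixed → ⊥-elim (m*2≢1+n*2 (toℕ (suc i)) h (selfNegating-suc⇒ i fixed)) }
  ; unique   = [] ∷ []
  }

selfNegating-even : ∀ h → Enumeration (SelfNegating {suc h * 2})
selfNegating-even h = record
  { elems    = zero List.∷ k/2 List.∷ List.[]
  ; sound    = refl ∷ selfNegating⇐ k/2 (cong (_* 2) toℕ-k/2) ∷ []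
  ; complete = complete′
  ; unique   = ((λ ()) ∷ []) ∷ [] ∷ []
  }
  where
  1+h<k : suc h < suc h * 2
  1+h<k = s≤s (s≤s (m≤m*n h 2))
  k/2 : Fin (suc h * 2)
  k/2 = fromℕ< 1+h<k
  toℕ-k/2 : toℕ k/2 ≡ suc h
  toℕ-k/2 = toℕ-fromℕ< 1+h<k
  complete′ : ∀ {c} → SelfNegating c → c ∈ zero List.∷ k/2 List.∷ List.[]
  complete′ {zero}  _     = here refl
  complete′ {suc i} fixed = there (here (toℕ-injective (trans toℕ-c (sym toℕ-k/2))))
    where
    toℕ-c : toℕ (suc i) ≡ suc h
    toℕ-c = *-cancelʳ-≡ (toℕ (suc i)) (suc h) 2 (selfNegating-suc⇒ i fixed)

selfNegating : ∀ k → 0 < k → Σ (Enumeration (SelfNegating {k})) λ S → length (elems S) ≡ delta k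
selfNegating k 0<k with evenOrOdd k
selfNegating _ ()  | even zero
... | even (suc h) = selfNegating-even h , sym (delta-even (suc h))
... | odd h        = selfNegating-odd h , sym (delta-odd h)

negSymEnclosures : Enumeration (NegSym {k} {n}) → Enumeration (NegSym {k} {suc (suc n)})
negSymEnclosures {k} E = record
  { elems    = cartesianProductWith enclose (allFin k) (elems E)
  ; sound    = All.cartesianProductWith⁺ (setoid _) (setoid _) enclose (allFin k) (elems E)
                 λ {a} _ w∈E → negSym-enclose a (All.lookup (sound E) w∈E)
  ; complete = complete′
  ; unique   = Unique.cartesianProductWith⁺ enclose enclose-injective (Unique.allFin⁺ k) (unique E)
  }
  where
  complete′ : ∀ {u} → NegSym u → u ∈ cartesianProductWith enclose (allFin k) (elems E)
  complete′ {a ∷ v} ns with initLast v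
  ... | w , b , refl with negSym-enclose⁻ a w b ns
  ...   | refl , w-ns =
    Any.cartesianProductWith⁺ enclose (λ { refl refl → refl }) (∈-allFin a) (complete E w-ns)

module _ (S : Enumeration (SelfNegating {k})) where

  negSymSingletons : Enumeration (NegSym {k} {1})
  negSymSingletons = record
    { elems    = List.map (_∷ []) (elems S)
    ; sound    = All.map⁺ (All.map (cong (_∷ [])) (sound S))
    ; complete = λ { {c ∷ []} ns → ∈-map⁺ (_∷ []) (complete S (∷-injectiveˡ ns)) }
    ; unique   = Unique.map⁺ ∷-injectiveˡ (unique S)
    }

  negSymTuples : ∀ n → Enumeration (NegSym {k} {n})
  negSymTuples zero          = record
    { elems    = List.[ [] ]
    ; sound    = refl ∷ []
    ; complete = λ { {[]} _ → here refl }
    ; unique   = [] ∷ []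
    }
  negSymTuples (suc zero)    = negSymSingletons
  negSymTuples (suc (suc n)) = negSymEnclosures (negSymTuples n)

  length-negSymTuples : ∀ q → length (elems (negSymTuples (suc (q * 2)))) ≡ length (elems S) * k ^ q
  length-negSymTuples zero    = trans (length-map (_∷ []) (elems S)) (sym (*-identityʳ _))
  length-negSymTuples (suc q) = begin
    length (cartesianProductWith enclose (allFin k) (elems (negSymTuples (suc (q * 2)))))
      ≡⟨ length-cartesianProductWith enclose (allFin k) _ ⟩
    length (allFin k) * length (elems (negSymTuples (suc (q * 2))))
      ≡⟨ cong₂ _*_ (length-tabulate {n = k} id) (length-negSymTuples q) ⟩
    k * (length (elems S) * k ^ q)
      ≡⟨ arith k (length (elems S)) (k ^ q) ⟩
    length (elems S) * (k * k ^ q)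
      ∎
    where
    arith : ∀ k s p → k * (s * p) ≡ s * (k * p)
    arith = solve-∀

module _ {k : ℕ} (q : ℕ) where

  negSym-edge-unique : (u v : Tuple k (suc (q * 2))) → NegSym u → NegSym v → EdgeOf v u → v ≡ u
  negSym-edge-unique u v u-ns v-ns v∈u with edgeOf⇒rot v∈u
  ... | i , refl = negSym-rot-unique q u i u-ns v-ns

  negSym⇒InN1 : {u : Tuple k (suc (q * 2))} → NegSym u → InN1 u
  negSym⇒InN1 {u} u-ns =
    negSym⇒InH u u-ns ,
    (u , u , rot-edgeOf u 0 , rot-edgeOf u 0 , u-ns) ,
    (u , rot-edgeOf u 0 , u-ns , λ v v∈u v-ns → negSym-edge-unique u v u-ns v-ns v∈u)

  negSym-sameCircuit⇒≡ : {u v : Tuple k (suc (q * 2))} →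
    NegSym u → NegSym v → SameCircuit u v → u ≡ v
  negSym-sameCircuit⇒≡ {u} {v} u-ns v-ns same =
    sym (negSym-edge-unique u v u-ns v-ns (Equivalence.from (same v) (rot-edgeOf v 0)))

  cardN1 : (E : Enumeration (NegSym {k} {suc (q * 2)})) → CardN1 (suc (q * 2)) k (length (elems E))
  cardN1 E = elems E , All.map negSym⇒InN1 (sound E) , covers , distinct , refl
    where
    covers : ∀ a → InN1 a → Any (SameCircuit a) (elems E)
    covers a (_ , _ , u , u∈a , u-ns , _) with edgeOf⇒rot u∈a
    ... | j , refl = Any.map (λ { refl → sameCircuit-rot a j }) (complete E u-ns)
    distinct : AllPairs (λ u v → ¬ SameCircuit u v) (elems E)
    distinct = allPairs-mapWith (λ u-ns v-ns u≢v → u≢v ∘ negSym-sameCircuit⇒≡ u-ns v-ns)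
                                (sound E) (unique E)

-- The argument only uses 0 < k, and it also covers n = 1.
lemma4p5 : ∀ (k n : ℕ) → 3 ≤ k → 3 ≤ n → n % 2 ≡ 1 →
    CardN1 n k (delta k * k ^ ((n ∸ 1) / 2))
lemma4p5 k n 3≤k _ n%2≡1 with evenOrOdd n
... | even h = contradiction (trans (sym ([n*2]%2≡0 h)) n%2≡1) 0≢1+n
... | odd q with selfNegating k (≤-trans (s≤s z≤n) 3≤k)
...   | S , |S|≡δ = subst (CardN1 (suc (q * 2)) k) count (cardN1 q (negSymTuples S (suc (q * 2))))
  where
  count : length (elems (negSymTuples S (suc (q * 2)))) ≡ delta k * k ^ ((q * 2) / 2)
  count = trans (length-negSymTuples S q) (cong₂ _*_ |S|≡δ (cong (k ^_) (sym (m*n/n≡m q 2))))
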